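{- Let $0\le\ell\le 2k-1$. In any configuration $H$ of the $(k,\ell)$-pebble game with colors, each pebble of color $c_i$ lying on a vertex $v$ is the root of a (possibly single-vertex) monochromatic tree-piece of color $c_i$. That is, the connected component containing $v$ of the subgraph of $H$ formed by the edges of color $c_i$ is a tree, and all its edges are directed towards $v$.
   Context: The $(k,\ell)$-pebble game with colors is played on a fixed finite vertex set $V$. Its state is a directed multigraph $H$ on $V$ (loops allowed) together with pebbles, each having one of $k$ colors $c_1,\dots,c_k$. Each pebble lies on a vertex or on an edge, and every edge carries exactly one pebble; the color of an edge is the color of its pebble. Initially $H$ has no edges and each vertex carries one pebble of each color. Moves: (add-edge) Let $v,w$ be vertices, not necessarily distinct, whose set $\{v,w\}$ carries at least $\ell+1$ pebbles in total, with $v$ carrying at least one pebble. Pick up a pebble from $v$, add the directed edge $vw$, and put that pebble on it. (pebble-slide) Let $w$ carry a pebble $p$ and let $vw$ be an edge. Replace $vw$ by $wv$, put the pebble from $vw$ onto $v$, and put $p$ on $wv$. A configuration is any state reachable from the initial one by finitely many moves. -}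

module Defs where

open import Data.Nat using (ℕ; zero; suc; _+_; _*_; _≤_; pred)
open import Data.Nat.DivMod using (_%_; m%n<n)
open import Data.Fin using (Fin; toℕ; fromℕ<; _≟_)
open import Data.Product using (_×_; _,_; Σ)
open import Data.Sum using (_⊎_)
open import Data.List using (List; []; _∷_; _++_; length; lookup; map; allFin)
open import Data.Nat.ListAction using (sum)
open import Data.List.Membership.Propositional using (_∈_)
open import Data.Empty using (⊥)
open import Relation.Nullary using (¬_; yes; no)
open import Relation.Binary.PropositionalEquality using (_≡_)
open import Relation.Binary.Construct.Closure.ReflexiveTransitive using (Star)
open import Function.Definitions using (Injective)

-- An edge is a directed edge (tail , head , color of its pebble).
Edge : ℕ → ℕ → Set
Edge n k = Fin n × Fin n × Fin k

-- State of the (k,ℓ)-pebble game with colors on vertex set Fin n: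
-- the multigraph H as a list of coloured directed edges (each edge carries
-- exactly one pebble, whose colour is recorded), and for each vertex v and
-- colour c the number of pebbles of colour c lying on v.
record State (n k : ℕ) : Set where
  constructor state
  field
    edges : List (Edge n k)
    peb   : Fin n → Fin k → ℕ
open State public

initial : ∀ {n k} → State n k
initial = state [] (λ _ _ → 1)

pebAt : ∀ {n k} → State n k → Fin n → ℕ
pebAt {k = k} s v = sum (map (peb s v) (allFin k))

pebOnPair : ∀ {n k} → State n k → Fin n → Fin n → ℕ
pebOnPair s v w with v ≟ w
... | yes _ = pebAt s v
... | no  _ = pebAt s v + pebAt s w

adjust : ∀ {n k} → (Fin n → Fin k → ℕ) → Fin n → Fin k → (ℕ → ℕ) → Fin n → Fin k → ℕ
adjust p v c f x d with x ≟ v | d ≟ c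
... | yes _ | yes _ = f (p x d)
... | _     | _     = p x d

data Step {n k : ℕ} (ℓ : ℕ) : State n k → State n k → Set where
  add-edge : ∀ (s : State n k) (v w : Fin n) (c : Fin k) →
             suc ℓ ≤ pebOnPair s v w →
             1 ≤ peb s v c →
             Step ℓ s (state ((v , w , c) ∷ edges s) (adjust (peb s) v c pred))
  pebble-slide : ∀ (s : State n k) (xs ys : List (Edge n k)) (v w : Fin n) (c c' : Fin k) →
             edges s ≡ xs ++ (v , w , c) ∷ ys →
             1 ≤ peb s w c' →
             Step ℓ s (state (xs ++ (w , v , c') ∷ ys)
                             (adjust (adjust (peb s) w c' pred) v c suc))

Configuration : ∀ {n k} → ℕ → State n k → Set
Configuration ℓ s = Star (Step ℓ) initial s

UAdj : ∀ {n k} → List (Edge n k) → Fin k → Fin n → Fin n → Set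
UAdj es c x y = ((x , y , c) ∈ es) ⊎ ((y , x , c) ∈ es)

InComp : ∀ {n k} → List (Edge n k) → Fin k → Fin n → Fin n → Set
InComp es c v u = Star (UAdj es c) v u

DirPath : ∀ {n k} → List (Edge n k) → Fin k → Fin n → Fin n → Set
DirPath es c x y = Star (λ a b → (a , b , c) ∈ es) x y

next : ∀ {m} → Fin (suc m) → Fin (suc m)
next {m} j = fromℕ< (m%n<n (suc (toℕ j)) (suc m))

-- A cycle (in the multigraph sense: loops and pairs of parallel edges count)
-- of colour-c edges inside the component of v: distinct vertices
-- vs 0 .. vs m and distinct edges ids 0 .. ids m (positions in the edge list)
-- with edge ids j joining vs j and vs (j+1 mod (m+1)).
record Cycle {n k : ℕ} (es : List (Edge n k)) (c : Fin k) (v : Fin n) : Set where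
  field
    m      : ℕ
    vs     : Fin (suc m) → Fin n
    vs-inj : Injective _≡_ _≡_ vs
    ids    : Fin (suc m) → Fin (length es)
    ids-inj : Injective _≡_ _≡_ ids
    joins  : ∀ j → (lookup es (ids j) ≡ (vs j , vs (next j) , c))
                 ⊎ (lookup es (ids j) ≡ (vs (next j) , vs j , c))
    inComp : InComp es c v (vs Fin.zero)

-- The colour-c component of v is a tree (it is connected by definition and
-- contains no cycle) whose edges are all directed towards v: for every edge
-- a → b of the component, the head b has a directed colour-c path to v
-- (i.e. the edge lies on a directed path from a to v).
TreePieceRootedAt : ∀ {n k} → List (Edge n k) → Fin k → Fin n → Set
TreePieceRootedAt {n} es c v =
  ¬ Cycle es c v ×
  (∀ (a b : Fin n) → (a , b , c) ∈ es → InComp es c v a → DirPath es c b v)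

-- Each (vertex, colour) pair owns exactly one token: the pebble of that colour
-- is either still on the vertex or lies on an out-edge of that colour leaving
-- it, and both moves preserve this. So in the colour-c subgraph every vertex
-- has out-degree at most 1, and a vertex v carrying a c-pebble is a sink.
-- Following the unique out-edges then leads from every vertex of the component
-- of v to v, so every edge points towards v. On a cycle the tails of the cycle
-- edges are pairwise distinct cycle vertices, hence all of them, so the walk
-- from a cycle vertex never leaves the cycle and cannot reach the sink v.
module Submission where

open import Defs
open import Data.Nat using (ℕ; suc; pred; _+_; _*_; _≤_; z≤n; s≤s; >-nonZero)
open import Data.Nat.Properties
  using (+-suc; suc-pred; m≤m+n; m≤n+m; ≤-trans; ≤-reflexive; +-monoʳ-≤;
         +-cancelʳ-≤; n≤0⇒n≡0; 1+n≰n)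
open import Data.Nat.ListAction using (sum)
open import Data.Nat.ListAction.Properties using (sum-↭)
open import Data.Fin using (Fin; zero; suc; _≟_; punchOut)
open import Data.Fin.Properties using (any?; injective⇒≤; punchOut-injective)
open import Data.Product using (_×_; _,_; ∃; proj₁; proj₂)
open import Data.Sum using (inj₁; inj₂)
open import Data.List using (List; _∷_; _++_; length; lookup; map)
open import Data.List.Relation.Unary.Any using (index)
open import Data.List.Relation.Unary.Any.Properties using (lookup-index)
open import Data.List.Membership.Propositional using (_∈_)
open import Data.List.Membership.Propositional.Properties using (∈-lookup)
open import Data.List.Relation.Binary.Permutation.Propositional using (_↭_; ↭-sym; ↭-swap; ↭-refl)
open import Data.List.Relation.Binary.Permutation.Propositional.Properties using (map⁺; shift)
open import Data.Empty using (⊥-elim)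
open import Relation.Nullary using (¬_; yes; no; contradiction)
open import Relation.Binary.PropositionalEquality
open import Relation.Binary.Construct.Closure.ReflexiveTransitive using (Star; ε; _◅_)
open import Function using (_∘_; id)
open import Function.Definitions using (Injective)

injective⇒surjective : ∀ {m} {f : Fin m → Fin m} → Injective _≡_ _≡_ f →
                       ∀ y → ∃ λ x → f x ≡ y
injective⇒surjective {suc m} {f} f-inj y with any? (λ x → f x ≟ y)
... | yes hit = hit
... | no miss = contradiction (injective⇒≤ punchOut-f-inj) 1+n≰n
  where
  f≢y : ∀ x → y ≢ f x
  f≢y x eq = miss (x , sym eq)

  punchOut-f-inj : Injective _≡_ _≡_ (λ x → punchOut (f≢y x))
  punchOut-f-inj = f-inj ∘ punchOut-injective (f≢y _) (f≢y _)

module _ {n k : ℕ} where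

  -- Defined with the same case split as adjust, so that the two unfold together.
  out : Edge n k → Fin n → Fin k → ℕ
  out (a , _ , e) x d with x ≟ a | d ≟ e
  ... | yes _ | yes _ = 1
  ... | _     | _     = 0

  outDeg : List (Edge n k) → Fin n → Fin k → ℕ
  outDeg es x d = sum (map (λ e → out e x d) es)

  out-tail : ∀ x y d → out (x , y , d) x d ≡ 1
  out-tail x y d with x ≟ x | d ≟ d
  ... | yes _   | yes _   = refl
  ... | no x≢x  | _       = contradiction refl x≢x
  ... | yes _   | no d≢d  = contradiction refl d≢d

  outDeg-↭ : ∀ {es es'} → es ↭ es' → ∀ x d → outDeg es x d ≡ outDeg es' x d
  outDeg-↭ p x d = sum-↭ (map⁺ (λ e → out e x d) p)

  lookup⇒1≤outDeg : ∀ {x y d} (es : List (Edge n k)) (i : Fin (length es)) →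
                    lookup es i ≡ (x , y , d) → 1 ≤ outDeg es x d
  lookup⇒1≤outDeg {x} {y} {d} (e ∷ es) zero refl rewrite out-tail x y d = s≤s z≤n
  lookup⇒1≤outDeg (e ∷ es) (suc i) eq = ≤-trans (lookup⇒1≤outDeg es i eq) (m≤n+m _ _)

  lookup⇒2≤outDeg : ∀ {x y z d} (es : List (Edge n k)) {i j : Fin (length es)} → i ≢ j →
                    lookup es i ≡ (x , y , d) → lookup es j ≡ (x , z , d) → 2 ≤ outDeg es x d
  lookup⇒2≤outDeg (e ∷ es) {zero} {zero} i≢j _ _ = contradiction refl i≢j
  lookup⇒2≤outDeg {x} {y} {d = d} (e ∷ es) {zero} {suc j} _ refl eqⱼ
    rewrite out-tail x y d = s≤s (lookup⇒1≤outDeg es j eqⱼ)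
  lookup⇒2≤outDeg {x} {z = z} {d} (e ∷ es) {suc i} {zero} _ eqᵢ refl
    rewrite out-tail x z d = s≤s (lookup⇒1≤outDeg es i eqᵢ)
  lookup⇒2≤outDeg (e ∷ es) {suc i} {suc j} i≢j eqᵢ eqⱼ =
    ≤-trans (lookup⇒2≤outDeg es (i≢j ∘ cong suc) eqᵢ eqⱼ) (m≤n+m _ _)

  ∈⇒1≤outDeg : ∀ {x y d} {es : List (Edge n k)} → (x , y , d) ∈ es → 1 ≤ outDeg es x d
  ∈⇒1≤outDeg {es = es} e∈ = lookup⇒1≤outDeg es (index e∈) (sym (lookup-index e∈))

  tokens : List (Edge n k) → (Fin n → Fin k → ℕ) → Fin n → Fin k → ℕ
  tokens es p x d = outDeg es x d + p x d

  tokens-↭ : ∀ {es es'} → es ↭ es' → ∀ p x d → tokens es p x d ≡ tokens es' p x d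
  tokens-↭ es↭es' p x d = cong (_+ p x d) (outDeg-↭ es↭es' x d)

  tokens-push : ∀ es p v w c x d → 1 ≤ p v c →
                tokens ((v , w , c) ∷ es) (adjust p v c pred) x d ≡ tokens es p x d
  tokens-push es p v w c x d p≥1 with x ≟ v | d ≟ c
  ... | yes refl | yes refl = trans (sym (+-suc _ _)) (cong (outDeg es x d +_) suc-pred-p)
    where
    suc-pred-p : suc (pred (p x d)) ≡ p x d
    suc-pred-p = suc-pred (p x d) {{>-nonZero p≥1}}
  ... | yes _    | no _     = refl
  ... | no _     | _        = refl

  tokens-pop : ∀ es p v w c x d →
               tokens es (adjust p v c suc) x d ≡ tokens ((v , w , c) ∷ es) p x d
  tokens-pop es p v w c x d with x ≟ v | d ≟ c
  ... | yes _ | yes _ = +-suc _ _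
  ... | yes _ | no _  = refl
  ... | no _  | _     = refl

  Balanced : State n k → Set
  Balanced s = ∀ x d → tokens (edges s) (peb s) x d ≡ 1

  step-preserves-Balanced : ∀ {ℓ} {s s' : State n k} → Step ℓ s s' → Balanced s → Balanced s'
  step-preserves-Balanced (add-edge s v w c _ p≥1) bal x d =
    trans (tokens-push (edges s) (peb s) v w c x d p≥1) (bal x d)
  step-preserves-Balanced (pebble-slide s xs ys v w c c' es≡ p≥1) bal x d = begin
    tokens (xs ++ e' ∷ ys) P'' x d  ≡⟨ tokens-↭ (shift e' xs ys) P'' x d ⟩
    tokens (e' ∷ zs) P'' x d        ≡⟨ tokens-pop (e' ∷ zs) P' v w c x d ⟩
    tokens (e ∷ e' ∷ zs) P' x d     ≡⟨ tokens-↭ (↭-swap e e' (↭-refl {x = zs})) P' x d ⟩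
    tokens (e' ∷ e ∷ zs) P' x d     ≡⟨ tokens-push (e ∷ zs) P w v c' x d p≥1 ⟩
    tokens (e ∷ zs) P x d           ≡⟨ tokens-↭ (↭-sym (shift e xs ys)) P x d ⟩
    tokens (xs ++ e ∷ ys) P x d     ≡⟨ cong (λ es → tokens es P x d) es≡ ⟨
    tokens (edges s) P x d          ≡⟨ bal x d ⟩
    1                               ∎
    where
    open ≡-Reasoning
    e e' : Edge n k
    e  = (v , w , c)
    e' = (w , v , c')
    zs = xs ++ ys
    P  = peb s
    P' = adjust P w c' pred
    P'' = adjust P' v c suc

  Star-preserves-Balanced : ∀ {ℓ} {s s' : State n k} → Star (Step ℓ) s s' → Balanced s → Balanced s'
  Star-preserves-Balanced ε              = id
  Star-preserves-Balanced (step ◅ steps) = Star-preserves-Balanced steps ∘ step-preserves-Balanced step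

  configuration⇒Balanced : ∀ {ℓ} {s : State n k} → Configuration ℓ s → Balanced s
  configuration⇒Balanced conf = Star-preserves-Balanced conf (λ _ _ → refl)

  Balanced⇒outDeg≤1 : ∀ {s : State n k} → Balanced s → ∀ x d → outDeg (edges s) x d ≤ 1
  Balanced⇒outDeg≤1 bal x d = ≤-trans (m≤m+n _ _) (≤-reflexive (bal x d))

  Balanced⇒pebble⇒outDeg≡0 : ∀ {s : State n k} → Balanced s → ∀ x d → 1 ≤ peb s x d →
                             outDeg (edges s) x d ≡ 0
  Balanced⇒pebble⇒outDeg≡0 bal x d p≥1 =
    n≤0⇒n≡0 (+-cancelʳ-≤ 1 _ 0 (≤-trans (+-monoʳ-≤ _ p≥1) (≤-reflexive (bal x d))))

module Functional {n k : ℕ} (es : List (Edge n k)) (c : Fin k)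
                  (outDeg≤1 : ∀ x → outDeg es x c ≤ 1) where

  same-tail⇒same-position : ∀ {x y z} {i j : Fin (length es)} →
    lookup es i ≡ (x , y , c) → lookup es j ≡ (x , z , c) → i ≡ j
  same-tail⇒same-position {x} {i = i} {j} eqᵢ eqⱼ with i ≟ j
  ... | yes i≡j = i≡j
  ... | no i≢j  = contradiction (≤-trans (lookup⇒2≤outDeg es i≢j eqᵢ eqⱼ) (outDeg≤1 x)) 1+n≰n

  head-unique : ∀ {x y z} → (x , y , c) ∈ es → (x , z , c) ∈ es → y ≡ z
  head-unique e∈ e'∈ = cong (proj₁ ∘ proj₂)
    (trans (lookup-index e∈) (trans (cong (lookup es) i≡j) (sym (lookup-index e'∈))))
    where
    i≡j : index e∈ ≡ index e'∈
    i≡j = same-tail⇒same-position (sym (lookup-index e∈)) (sym (lookup-index e'∈))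

  module _ {v : Fin n} (cyc : Cycle es c v) where
    open Cycle cyc

    tailIx headIx : Fin (suc m) → Fin (suc m)
    tailIx j with joins j
    ... | inj₁ _ = j
    ... | inj₂ _ = next j
    headIx j with joins j
    ... | inj₁ _ = next j
    ... | inj₂ _ = j

    lookup-ids : ∀ j → lookup es (ids j) ≡ (vs (tailIx j) , vs (headIx j) , c)
    lookup-ids j with joins j
    ... | inj₁ forward  = forward
    ... | inj₂ backward = backward

    tailIx-injective : Injective _≡_ _≡_ tailIx
    tailIx-injective {i} {j} tᵢ≡tⱼ = ids-inj (same-tail⇒same-position (lookup-ids i)
      (subst (λ t → lookup es (ids j) ≡ (vs t , vs (headIx j) , c)) (sym tᵢ≡tⱼ) (lookup-ids j)))

    cycle-out-edge : ∀ i → ∃ λ i' → (vs i , vs i' , c) ∈ es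
    cycle-out-edge i with injective⇒surjective tailIx-injective i
    ... | j , refl = headIx j , subst (_∈ es) (lookup-ids j) (∈-lookup (ids j))

  module Sink {v : Fin n} (sink : outDeg es v c ≡ 0) where

    sink-has-no-out-edge : ∀ {y} → ¬ (v , y , c) ∈ es
    sink-has-no-out-edge e∈ with () ← subst (1 ≤_) sink (∈⇒1≤outDeg e∈)

    follow-out-edge : ∀ {a b} → (a , b , c) ∈ es → DirPath es c a v → DirPath es c b v
    follow-out-edge e∈ ε = ⊥-elim (sink-has-no-out-edge e∈)
    follow-out-edge e∈ (e'∈ ◅ path) = subst (λ y → DirPath es c y v) (head-unique e'∈ e∈) path

    walk-preserves-DirPath : ∀ {x u} → DirPath es c x v → Star (UAdj es c) x u → DirPath es c u v
    walk-preserves-DirPath path ε = path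
    walk-preserves-DirPath path (inj₁ e∈ ◅ walk) = walk-preserves-DirPath (follow-out-edge e∈ path) walk
    walk-preserves-DirPath path (inj₂ e∈ ◅ walk) = walk-preserves-DirPath (e∈ ◅ path) walk

    InComp⇒DirPath : ∀ {u} → InComp es c v u → DirPath es c u v
    InComp⇒DirPath = walk-preserves-DirPath ε

    out-closed⇒¬DirPath : (S : Fin n → Set) → (∀ {x} → S x → ∃ λ y → S y × (x , y , c) ∈ es) →
                          ∀ {x} → S x → ¬ DirPath es c x v
    out-closed⇒¬DirPath S closed Sx ε = sink-has-no-out-edge (proj₂ (proj₂ (closed Sx)))
    out-closed⇒¬DirPath S closed Sx (e∈ ◅ path) with closed Sx
    ... | y , Sy , e'∈ = out-closed⇒¬DirPath S closed (subst S (head-unique e'∈ e∈) Sy) path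

    ¬Cycle : ¬ Cycle es c v
    ¬Cycle cyc = out-closed⇒¬DirPath OnCycle closed (zero , refl) (InComp⇒DirPath inComp)
      where
      open Cycle cyc
      OnCycle : Fin n → Set
      OnCycle x = ∃ λ i → vs i ≡ x
      closed : ∀ {x} → OnCycle x → ∃ λ y → OnCycle y × (x , y , c) ∈ es
      closed (i , refl) with cycle-out-edge cyc i
      ... | i' , e∈ = vs i' , (i' , refl) , e∈

    treePiece : TreePieceRootedAt es c v
    treePiece = ¬Cycle , λ a b e∈ a∈comp → follow-out-edge e∈ (InComp⇒DirPath a∈comp)

lemma6 : ∀ (n k ℓ : ℕ) → ℓ + 1 ≤ 2 * k →
    ∀ (s : State n k) → Configuration ℓ s →
    ∀ (v : Fin n) (c : Fin k) → 1 ≤ peb s v c →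
    TreePieceRootedAt (edges s) c v
lemma6 n k ℓ _ s conf v c v-has-pebble =
  Functional.Sink.treePiece (edges s) c (λ x → Balanced⇒outDeg≤1 {s = s} bal x c)
    (Balanced⇒pebble⇒outDeg≡0 {s = s} bal v c v-has-pebble)
  where
  bal : Balanced s
  bal = configuration⇒Balanced conf
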